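{- Let $n,k,t$ be positive integers with $k,t\le n$. Then (i) $\left[{n\atop k/0}\right]=\left[{n\atop k-1/1}\right]$; (ii) $\left[{n\atop 1/t}\right]=\left[{n\atop t}\right]$; (iii) $\left[{n\atop 1/n-1}\right]=\binom{n}{2}=\left[{n\atop n-1}\right]$; (iv) $\left[{n\atop 2/n-1}\right]=n$; (v) $\left[{n\atop n-t+1/t}\right]=\frac{n!}{t!}$.
   Context: $\left[{n\atop m}\right]$ is the signless Stirling number of the first kind (number of permutations of $[n]$ with exactly $m$ cycles). For integers $n\ge0$, $k\ge1$, $t\ge0$, a mixed coloured permutation of $[n]$ is a permutation of $[n]$ together with a colouring of its cycles with colours from $\{1,\ldots,k\}$ such that exactly $t$ cycles receive colour $1$ (the special colour) and each of the colours $2,\ldots,k$ is used on exactly one cycle (so there are $t+k-1$ cycles); $\left[{n\atop k/t}\right]$ denotes their number. For $j\ge 0$, $\left[{n\atop j/1}\right]$ is the number of permutations of $[n]$ with $j$ cycles coloured bijectively by $j$ distinct colours. -}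

module Defs where

open import Data.Bool using (Bool; true; false; _∧_; _∨_; not; if_then_else_)
open import Data.Nat using (ℕ; zero; suc; _+_; _∸_; _≡ᵇ_; _≤ᵇ_; _!; _/_)
open import Data.Nat.Properties using (_!≢0)
open import Data.Fin using (Fin; toℕ)
open import Data.Vec using (Vec; []; _∷_; lookup)
open import Data.List using (List; []; _∷_; [_]; map; concatMap; allFin; filterᵇ; length; upTo)
open import Data.Bool.ListAction using (all)
open import Data.Product using (_×_; _,_; proj₁; proj₂)

-- A permutation of [n] is encoded as a vector σ : Vec (Fin n) n (σ(i) = lookup σ i)
-- which is injective; a colouring of its cycles by k colours is encoded as a
-- vector col : Vec (Fin k) n which is constant on cycles (col(σ i) = col i).
-- Colour 1 (the special colour) is `Fin.zero`.

allVecs : (k n : ℕ) → List (Vec (Fin k) n)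
allVecs k zero = [ [] ]
allVecs k (suc n) = concatMap (λ x → map (x ∷_) (allVecs k n)) (allFin k)

_≡ᶠ_ : ∀ {m} → Fin m → Fin m → Bool
i ≡ᶠ j = toℕ i ≡ᵇ toℕ j

count : ∀ {A : Set} → (A → Bool) → List A → ℕ
count p xs = length (filterᵇ p xs)

-- σ is injective (hence a bijection of the finite set Fin n)
isPerm : ∀ {n} → Vec (Fin n) n → Bool
isPerm {n} σ = all (λ i → all (λ j → not (lookup σ i ≡ᶠ lookup σ j) ∨ (i ≡ᶠ j)) (allFin n)) (allFin n)

iter : ∀ {n} → Vec (Fin n) n → ℕ → Fin n → Fin n
iter σ zero i = i
iter σ (suc j) i = lookup σ (iter σ j i)

-- i is the least element of its cycle (cycles have length ≤ n)
isCycleMin : ∀ {n} → Vec (Fin n) n → Fin n → Bool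
isCycleMin {n} σ i = all (λ j → toℕ i ≤ᵇ toℕ (iter σ j i)) (upTo n)

cycles : ∀ {n} → Vec (Fin n) n → ℕ
cycles {n} σ = count (isCycleMin σ) (allFin n)

cyclesOfColour : ∀ {n k} → Vec (Fin n) n → Vec (Fin k) n → Fin k → ℕ
cyclesOfColour {n} σ col c = count (λ i → isCycleMin σ i ∧ (lookup col i ≡ᶠ c)) (allFin n)

isCycleColouring : ∀ {n k} → Vec (Fin n) n → Vec (Fin k) n → Bool
isCycleColouring {n} σ col = all (λ i → lookup col (lookup σ i) ≡ᶠ lookup col i) (allFin n)

isSpecial : ∀ {k} → Fin k → Bool
isSpecial c = toℕ c ≡ᵇ 0

-- mixed colouring: exactly t cycles of colour 1, each other colour on exactly one
-- cycle, and t + k - 1 cycles in total (automatic for k ≥ 1; for k = 0, t = 1 it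
-- gives the convention [n, 0/1] = permutations with 0 cycles)
isMixed : ∀ {n k} → ℕ → Vec (Fin n) n → Vec (Fin k) n → Bool
isMixed {n} {k} t σ col =
  isPerm σ ∧ isCycleColouring σ col ∧ (cycles σ ≡ᵇ (t + k ∸ 1)) ∧
  all (λ c → cyclesOfColour σ col c ≡ᵇ (if isSpecial c then t else 1)) (allFin k)

pairs : ∀ {A B : Set} → List A → List B → List (A × B)
pairs xs ys = concatMap (λ x → map (x ,_) ys) xs

stirling1 : ℕ → ℕ → ℕ
stirling1 n m = count (λ σ → isPerm σ ∧ (cycles σ ≡ᵇ m)) (allVecs n n)

mixedStirling : ℕ → ℕ → ℕ → ℕ
mixedStirling n k t = count (λ p → isMixed t (proj₁ p) (proj₂ p)) (pairs (allVecs n n) (allVecs k n))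

factQuot : ℕ → ℕ → ℕ
factQuot n t = _/_ (n !) (t !) {{t !≢0}}

module Submission where

-- Then
--   (ii)  with one colour the colouring is forced, so [n,1/t] = [n t];
--   (i)   with t = 0 the special colour is unused (every colour in use is the
--         colour of a cycle minimum), and shifting colours down by one is a
--         bijection onto colourings with k-1 colours and one special cycle;
--   (v)   n-t+1 colours with t special cycles need n cycles, i.e. the
--         identity, whose mixed colourings are the words with letter counts
--         (t,1,...,1); the multinomial identity  #words · t! = n!  counts them;
--   (iv)  is the instance t = n-1 of the same count;
--   (iii) permutations with n-1 cycles are exactly the transpositions (y J)
--         with y < J, whence [n, n-1] = ∑_J J = n C 2; (ii) gives the mixed
--         version.

open import Defs
open import Data.Bool using (Bool; true; false; _∧_; _∨_; not; if_then_else_; T)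
open import Data.Bool.Properties using (T-≡; ∧-identityʳ; ∧-zeroʳ; ∧-idem)
open import Data.Bool.ListAction using (all)
open import Data.Nat using (ℕ; zero; suc; _+_; _*_; _∸_; _≤_; _<_; z≤n; s≤s; _≡ᵇ_; _<ᵇ_; _!; _/_)
open import Data.Nat.Properties
  using ( +-*-semiring; *-commutativeSemigroup; +-identityʳ; +-suc; +-comm; *-assoc; *-identityʳ
        ; *-cancelʳ-≡; _!≢0
        ; suc-injective; m+n≡0⇒m≡0; m+n≡0⇒n≡0; m+n∸n≡m; m+[n∸m]≡n; m∸n≤m; m<n⇒0<n∸m
        ; ≤-refl; ≤-reflexive; ≤-trans; ≤-antisym; ≤-pred; <-irrefl; <⇒≤; <⇒≱; ≰⇒>; ≤∧≢⇒<
        ; n<1+n; m≤n⇒m≤1+n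
        ; ≡ᵇ⇒≡; ≡⇒≡ᵇ; ≤ᵇ⇒≤; ≤⇒≤ᵇ; <ᵇ⇒<; <⇒<ᵇ )
open import Data.Nat.ListAction using () renaming (sum to sumList)
open import Data.Nat.ListAction.Properties using (sum-++)
open import Data.Nat.Combinatorics using (_C_; nC1≡n; nCk+nC[k+1]≡[n+1]C[k+1])
open import Data.Nat.DivMod using (m*n/n≡m)
open import Data.Nat.Induction using (<-rec)
open import Data.Fin using (Fin; toℕ; punchIn) renaming (zero to fz; suc to fs)
open import Data.Fin.Properties using (toℕ-injective; toℕ<n; pigeonhole; punchInᵢ≢i) renaming (_≟_ to _≟ᶠ_)
open import Data.Vec using (Vec; []; _∷_; lookup; tabulate; replicate) renaming (map to vmap)
open import Data.Vec.Properties
  using (∷-injectiveˡ; ∷-injectiveʳ; lookup-map; lookup∘tabulate; tabulate∘lookup; tabulate-cong; ≡-dec)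
open import Data.List using (List; []; _∷_; map; concatMap; allFin; applyUpTo)
import Data.List as L
open import Data.List.Properties using (map-++; map-∘; map-cong)
open import Data.Product using (_×_; _,_; proj₁; proj₂; ∃-syntax)
open import Data.Sum using (_⊎_; inj₁; inj₂)
open import Data.Empty using (⊥; ⊥-elim)
open import Function using (_∘_; id)
open import Function.Bundles using (Equivalence)
open import Relation.Nullary using (Dec; yes; no; does)
open import Relation.Nullary.Decidable using (dec-true; dec-false)
open import Relation.Binary.PropositionalEquality
open import Algebra.Properties.CommutativeSemigroup *-commutativeSemigroup using () renaming (x∙yz≈y∙xz to *-leftComm)
open import Algebra.Properties.Semiring.Sum +-*-semiring
  using (sum; sum-syntax; sum-cong-≗; sum-remove; ∑-comm; ∑-distrib-+; sum-replicate-zero; *-distribʳ-sum)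

ind : Bool → ℕ
ind true = 1
ind false = 0

true≢false : true ≢ false
true≢false ()

ind-≢true : ∀ {b} → b ≢ true → ind b ≡ 0
ind-≢true {true} b≢true = ⊥-elim (b≢true refl)
ind-≢true {false} _ = refl

∧-true : ∀ {a b} → a ∧ b ≡ true → a ≡ true × b ≡ true
∧-true {true} e = refl , e

≡ᵇ-sound : ∀ m n → (m ≡ᵇ n) ≡ true → m ≡ n
≡ᵇ-sound m n e = ≡ᵇ⇒≡ m n (Equivalence.from T-≡ e)

≡ᵇ-complete : ∀ m n → m ≡ n → (m ≡ᵇ n) ≡ true
≡ᵇ-complete m n e = Equivalence.to T-≡ (≡⇒≡ᵇ m n e)

≡ᶠ-sound : ∀ {m} {i j : Fin m} → (i ≡ᶠ j) ≡ true → i ≡ j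
≡ᶠ-sound {i = i} {j} e = toℕ-injective (≡ᵇ-sound (toℕ i) (toℕ j) e)

≡ᶠ-refl : ∀ {m} (i : Fin m) → (i ≡ᶠ i) ≡ true
≡ᶠ-refl i = ≡ᵇ-complete (toℕ i) (toℕ i) refl

≡ᶠ-false : ∀ {m} {i j : Fin m} → i ≢ j → (i ≡ᶠ j) ≡ false
≡ᶠ-false {i = i} {j} i≢j with i ≡ᶠ j in e
... | true = ⊥-elim (i≢j (≡ᶠ-sound e))
... | false = refl

all-tabulate⁻ : ∀ {A : Set} {n} (p : A → Bool) (g : Fin n → A) →
  all p (L.tabulate g) ≡ true → ∀ i → p (g i) ≡ true
all-tabulate⁻ p g e fz = proj₁ (∧-true e)
all-tabulate⁻ p g e (fs i) = all-tabulate⁻ p (g ∘ fs) (proj₂ (∧-true {p (g fz)} e)) i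

all-tabulate⁺ : ∀ {A : Set} {n} (p : A → Bool) (g : Fin n → A) →
  (∀ i → p (g i) ≡ true) → all p (L.tabulate g) ≡ true
all-tabulate⁺ {n = zero} p g h = refl
all-tabulate⁺ {n = suc n} p g h rewrite h fz = all-tabulate⁺ p (g ∘ fs) (h ∘ fs)

all-tabulate-cong : ∀ {A B : Set} {n} (p : A → Bool) (q : B → Bool) (g : Fin n → A) (h : Fin n → B) →
  (∀ i → p (g i) ≡ q (h i)) → all p (L.tabulate g) ≡ all q (L.tabulate h)
all-tabulate-cong {n = zero} p q g h e = refl
all-tabulate-cong {n = suc n} p q g h e = cong₂ _∧_ (e fz) (all-tabulate-cong p q (g ∘ fs) (h ∘ fs) (e ∘ fs))

all-upTo⁻ : ∀ {A : Set} (p : A → Bool) (f : ℕ → A) n →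
  all p (applyUpTo f n) ≡ true → ∀ j → j < n → p (f j) ≡ true
all-upTo⁻ p f (suc n) e zero _ = proj₁ (∧-true e)
all-upTo⁻ p f (suc n) e (suc j) (s≤s j<n) = all-upTo⁻ p (f ∘ suc) n (proj₂ (∧-true {p (f 0)} e)) j j<n

all-upTo⁺ : ∀ {A : Set} (p : A → Bool) (f : ℕ → A) n →
  (∀ j → j < n → p (f j) ≡ true) → all p (applyUpTo f n) ≡ true
all-upTo⁺ p f zero h = refl
all-upTo⁺ p f (suc n) h rewrite h 0 (s≤s z≤n) = all-upTo⁺ p (f ∘ suc) n (λ j j<n → h (suc j) (s≤s j<n))

all-upTo-false : ∀ {A : Set} (p : A → Bool) (f : ℕ → A) n →
  all p (applyUpTo f n) ≡ false → ∃[ j ] (j < n × p (f j) ≡ false)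
all-upTo-false p f (suc n) e with p (f 0) in e0
... | false = 0 , s≤s z≤n , e0
... | true with all-upTo-false p (f ∘ suc) n e
... | j , j<n , ej = suc j , s≤s j<n , ej

∑-zero : ∀ {n} {f : Fin n → ℕ} → (∀ i → f i ≡ 0) → ∑[ i < n ] f i ≡ 0
∑-zero {n} h = trans (sum-cong-≗ h) (sum-replicate-zero n)

∑-zero⁻ : ∀ {n} (f : Fin n → ℕ) → ∑[ i < n ] f i ≡ 0 → ∀ i → f i ≡ 0
∑-zero⁻ f e fz = m+n≡0⇒m≡0 (f fz) e
∑-zero⁻ f e (fs i) = ∑-zero⁻ (f ∘ fs) (m+n≡0⇒n≡0 (f fz) e) i

∑-single : ∀ {n} (f : Fin n → ℕ) (i : Fin n) → (∀ j → j ≢ i → f j ≡ 0) → ∑[ j < n ] f j ≡ f i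
∑-single {suc n} f i h = begin
  sum f                              ≡⟨ sum-remove f ⟩
  f i + ∑[ j < n ] f (punchIn i j)   ≡⟨ cong (f i +_) (∑-zero (λ j → h _ (punchInᵢ≢i i j))) ⟩
  f i + 0                            ≡⟨ +-identityʳ (f i) ⟩
  f i                                ∎
  where
  open ≡-Reasoning

∑ind-all : ∀ {n} (p : Fin n → Bool) → (∀ i → p i ≡ true) → ∑[ i < n ] ind (p i) ≡ n
∑ind-all {zero} p h = refl
∑ind-all {suc n} p h rewrite h fz = cong suc (∑ind-all (p ∘ fs) (h ∘ fs))

∑ind-≤ : ∀ {n} (p : Fin n → Bool) → ∑[ i < n ] ind (p i) ≤ n
∑ind-≤ {zero} p = z≤n
∑ind-≤ {suc n} p with p fz
... | true = s≤s (∑ind-≤ (p ∘ fs))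
... | false = m≤n⇒m≤1+n (∑ind-≤ (p ∘ fs))

∑ind-full : ∀ {n} (p : Fin n → Bool) → ∑[ i < n ] ind (p i) ≡ n → ∀ i → p i ≡ true
∑ind-full {suc n} p e i with p fz in p0
∑ind-full {suc n} p e fz | true = p0
∑ind-full {suc n} p e (fs i) | true = ∑ind-full (p ∘ fs) (suc-injective e) i
... | false = ⊥-elim (<⇒≱ (s≤s (∑ind-≤ (p ∘ fs))) (≤-reflexive (sym e)))

∑ind-allBut : ∀ {n} (p : Fin (suc n) → Bool) J → p J ≡ false →
  (∀ i → i ≢ J → p i ≡ true) → ∑[ i < suc n ] ind (p i) ≡ n
∑ind-allBut p J pJ h =
  trans (sum-remove {i = J} (ind ∘ p))
        (cong₂ _+_ (cong ind pJ) (∑ind-all (p ∘ punchIn J) (λ j → h _ (punchInᵢ≢i J j))))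

∑ind-unique-false : ∀ {n} (p : Fin (suc n) → Bool) → ∑[ i < suc n ] ind (p i) ≡ n →
  ∃[ J ] (p J ≡ false × (∀ i → i ≢ J → p i ≡ true))
∑ind-unique-false {n} p e with p fz in p0
... | false = fz , p0 , others
  where
  others : ∀ i → i ≢ fz → p i ≡ true
  others fz i≢0 = ⊥-elim (i≢0 refl)
  others (fs i) _ = ∑ind-full (p ∘ fs) e i
∑ind-unique-false {zero} p () | true
∑ind-unique-false {suc n} p e | true with ∑ind-unique-false (p ∘ fs) (suc-injective e)
... | J , pJ , h = fs J , pJ , others
  where
  others : ∀ i → i ≢ fs J → p i ≡ true
  others fz _ = p0
  others (fs i) i≢J = h i (i≢J ∘ cong fs)

∑ind-below : ∀ n j → j ≤ n → ∑[ y < n ] ind (toℕ y <ᵇ j) ≡ j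
∑ind-below zero zero _ = refl
∑ind-below (suc n) zero _ = ∑-zero {n} (λ _ → refl)
∑ind-below (suc n) (suc j) (s≤s j≤n) = cong suc (∑ind-below n j j≤n)

∑-toℕ : ∀ n → ∑[ i < n ] toℕ i ≡ n C 2
∑-toℕ zero = refl
∑-toℕ (suc n) = begin
  ∑[ i < n ] (1 + toℕ i)           ≡⟨ ∑-distrib-+ {n} (λ _ → 1) toℕ ⟩
  ∑[ i < n ] 1 + ∑[ i < n ] toℕ i  ≡⟨ cong₂ _+_ (∑ind-all {n} (λ _ → true) (λ _ → refl)) (∑-toℕ n) ⟩
  n + n C 2                        ≡⟨ cong (_+ n C 2) (nC1≡n n) ⟨
  n C 1 + n C 2                    ≡⟨ nCk+nC[k+1]≡[n+1]C[k+1] n 1 ⟩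
  suc n C 2                        ∎
  where open ≡-Reasoning

∑ᵛ : ∀ k n → (Vec (Fin k) n → ℕ) → ℕ
∑ᵛ k zero f = f []
∑ᵛ k (suc n) f = ∑[ x < k ] ∑ᵛ k n (λ v → f (x ∷ v))

∑ᵛ-cong : ∀ k n {f g : Vec (Fin k) n → ℕ} → (∀ v → f v ≡ g v) → ∑ᵛ k n f ≡ ∑ᵛ k n g
∑ᵛ-cong k zero h = h []
∑ᵛ-cong k (suc n) h = sum-cong-≗ (λ x → ∑ᵛ-cong k n (λ v → h (x ∷ v)))

∑ᵛ-zero : ∀ k n {f : Vec (Fin k) n → ℕ} → (∀ v → f v ≡ 0) → ∑ᵛ k n f ≡ 0
∑ᵛ-zero k zero h = h []
∑ᵛ-zero k (suc n) h = ∑-zero (λ x → ∑ᵛ-zero k n (λ v → h (x ∷ v)))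

∑ᵛ-single : ∀ k n (f : Vec (Fin k) n → ℕ) (v : Vec (Fin k) n) →
  (∀ w → w ≢ v → f w ≡ 0) → ∑ᵛ k n f ≡ f v
∑ᵛ-single k zero f [] h = refl
∑ᵛ-single k (suc n) f (x ∷ v) h =
  trans (∑-single _ x (λ y y≢x → ∑ᵛ-zero k n (λ w → h (y ∷ w) (y≢x ∘ ∷-injectiveˡ))))
        (∑ᵛ-single k n (λ w → f (x ∷ w)) v (λ w w≢v → h (x ∷ w) (w≢v ∘ ∷-injectiveʳ)))

∑ᵛ-swap : ∀ k n {m} (f : Vec (Fin k) n → Fin m → ℕ) →
  ∑ᵛ k n (λ v → ∑[ i < m ] f v i) ≡ ∑[ i < m ] ∑ᵛ k n (λ v → f v i)
∑ᵛ-swap k zero f = refl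
∑ᵛ-swap k (suc n) f =
  trans (sum-cong-≗ (λ x → ∑ᵛ-swap k n (λ v → f (x ∷ v))))
        (∑-comm (λ x i → ∑ᵛ k n (λ v → f (x ∷ v) i)))

∑ᵛ-unary : ∀ n (f : Vec (Fin 1) n → ℕ) → ∑ᵛ 1 n f ≡ f (replicate n fz)
∑ᵛ-unary zero f = refl
∑ᵛ-unary (suc n) f = trans (+-identityʳ _) (∑ᵛ-unary n (λ v → f (fz ∷ v)))

∑ᵛ-avoid-zero : ∀ k n (f : Vec (Fin (suc k)) n → ℕ) →
  (∀ v i → lookup v i ≡ fz → f v ≡ 0) → ∑ᵛ (suc k) n f ≡ ∑ᵛ k n (f ∘ vmap fs)
∑ᵛ-avoid-zero k zero f h = refl
∑ᵛ-avoid-zero k (suc n) f h =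
  cong₂ _+_ (∑ᵛ-zero (suc k) n (λ v → h (fz ∷ v) fz refl))
            (sum-cong-≗ (λ x → ∑ᵛ-avoid-zero k n (λ v → f (fs x ∷ v)) (λ v i → h (fs x ∷ v) (fs i))))

count-as-sum : ∀ {A : Set} (p : A → Bool) xs → count p xs ≡ sumList (map (ind ∘ p) xs)
count-as-sum p [] = refl
count-as-sum p (x ∷ xs) with p x
... | true = cong suc (count-as-sum p xs)
... | false = count-as-sum p xs

count-cong : ∀ {A : Set} {p q : A → Bool} → (∀ x → p x ≡ q x) → ∀ xs → count p xs ≡ count q xs
count-cong {p = p} {q} h xs =
  trans (count-as-sum p xs) (trans (cong sumList (map-cong (cong ind ∘ h) xs)) (sym (count-as-sum q xs)))

sum-map-concatMap : ∀ {A B : Set} (f : B → ℕ) (g : A → List B) xs →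
  sumList (map f (concatMap g xs)) ≡ sumList (map (λ x → sumList (map f (g x))) xs)
sum-map-concatMap f g [] = refl
sum-map-concatMap f g (x ∷ xs) =
  trans (cong sumList (map-++ f (g x) (concatMap g xs)))
        (trans (sum-++ (map f (g x)) (map f (concatMap g xs)))
               (cong (sumList (map f (g x)) +_) (sum-map-concatMap f g xs)))

sum-map-tabulate : ∀ {A : Set} {n} (f : A → ℕ) (g : Fin n → A) →
  sumList (map f (L.tabulate g)) ≡ ∑[ i < n ] f (g i)
sum-map-tabulate {n = zero} f g = refl
sum-map-tabulate {n = suc n} f g = cong (f (g fz) +_) (sum-map-tabulate f (g ∘ fs))

sum-map-allVecs : ∀ k n (f : Vec (Fin k) n → ℕ) → sumList (map f (allVecs k n)) ≡ ∑ᵛ k n f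
sum-map-allVecs k zero f = +-identityʳ (f [])
sum-map-allVecs k (suc n) f =
  trans (sum-map-concatMap f (λ x → map (x ∷_) (allVecs k n)) (allFin k))
        (trans (sum-map-tabulate row id) (sum-cong-≗ row≡∑ᵛ))
  where
  row : Fin k → ℕ
  row x = sumList (map f (map (x ∷_) (allVecs k n)))
  row≡∑ᵛ : ∀ x → row x ≡ ∑ᵛ k n (λ v → f (x ∷ v))
  row≡∑ᵛ x = trans (cong sumList (sym (map-∘ {g = f} {f = x ∷_} (allVecs k n))))
                   (sum-map-allVecs k n (λ v → f (x ∷ v)))

count-allFin : ∀ {n} (p : Fin n → Bool) → count p (allFin n) ≡ ∑[ i < n ] ind (p i)
count-allFin {n} p = trans (count-as-sum p (allFin n)) (sum-map-tabulate (ind ∘ p) id)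

count-allVecs : ∀ k n (p : Vec (Fin k) n → Bool) → count p (allVecs k n) ≡ ∑ᵛ k n (ind ∘ p)
count-allVecs k n p = trans (count-as-sum p (allVecs k n)) (sum-map-allVecs k n (ind ∘ p))

hasCycles : ∀ {n} → Vec (Fin n) n → ℕ → Bool
hasCycles σ m = isPerm σ ∧ (cycles σ ≡ᵇ m)

stirling1-as-sum : ∀ n m → stirling1 n m ≡ ∑ᵛ n n (λ σ → ind (hasCycles σ m))
stirling1-as-sum n m = count-allVecs n n (λ σ → hasCycles σ m)

mixedStirling-as-sum : ∀ n k t →
  mixedStirling n k t ≡ ∑ᵛ n n (λ σ → ∑ᵛ k n (λ col → ind (isMixed t σ col)))
mixedStirling-as-sum n k t = begin
  count p (pairs perms colourings)
    ≡⟨ count-as-sum p (pairs perms colourings) ⟩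
  sumList (map (ind ∘ p) (concatMap (λ σ → map (σ ,_) colourings) perms))
    ≡⟨ sum-map-concatMap (ind ∘ p) (λ σ → map (σ ,_) colourings) perms ⟩
  sumList (map (λ σ → sumList (map (ind ∘ p) (map (σ ,_) colourings))) perms)
    ≡⟨ cong sumList (map-cong inner perms) ⟩
  sumList (map (λ σ → ∑ᵛ k n (λ col → ind (isMixed t σ col))) perms)
    ≡⟨ sum-map-allVecs n n _ ⟩
  ∑ᵛ n n (λ σ → ∑ᵛ k n (λ col → ind (isMixed t σ col)))
    ∎
  where
  open ≡-Reasoning
  perms : List (Vec (Fin n) n)
  perms = allVecs n n
  colourings : List (Vec (Fin k) n)
  colourings = allVecs k n
  p : Vec (Fin n) n × Vec (Fin k) n → Bool
  p (σ , col) = isMixed t σ col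
  inner : ∀ σ → sumList (map (ind ∘ p) (map (σ ,_) colourings)) ≡ ∑ᵛ k n (λ col → ind (isMixed t σ col))
  inner σ = trans (cong sumList (sym (map-∘ colourings))) (sum-map-allVecs k n (λ col → ind (isMixed t σ col)))

perm-injective : ∀ {n} (σ : Vec (Fin n) n) → isPerm σ ≡ true →
  ∀ i j → lookup σ i ≡ lookup σ j → i ≡ j
perm-injective σ isPermσ i j σi≡σj =
  ≡ᶠ-sound (injectivity-test (all-tabulate⁻ _ id (all-tabulate⁻ _ id isPermσ i) j))
  where
  injectivity-test : not (lookup σ i ≡ᶠ lookup σ j) ∨ (i ≡ᶠ j) ≡ true → (i ≡ᶠ j) ≡ true
  injectivity-test h rewrite σi≡σj | ≡ᶠ-refl (lookup σ j) = h

perm-from-injective : ∀ {n} (σ : Vec (Fin n) n) →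
  (∀ i j → lookup σ i ≡ lookup σ j → i ≡ j) → isPerm σ ≡ true
perm-from-injective σ inj = all-tabulate⁺ _ id (λ i → all-tabulate⁺ _ id (injectivity-test i))
  where
  injectivity-test : ∀ i j → not (lookup σ i ≡ᶠ lookup σ j) ∨ (i ≡ᶠ j) ≡ true
  injectivity-test i j with lookup σ i ≡ᶠ lookup σ j in e
  ... | false = refl
  ... | true rewrite inj i j (≡ᶠ-sound e) = ≡ᶠ-refl j

iter-+ : ∀ {n} (σ : Vec (Fin n) n) a b x → iter σ (a + b) x ≡ iter σ a (iter σ b x)
iter-+ σ zero b x = refl
iter-+ σ (suc a) b x = cong (lookup σ) (iter-+ σ a b x)

iter-lookup : ∀ {n} (σ : Vec (Fin n) n) c x → iter σ c (lookup σ x) ≡ lookup σ (iter σ c x)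
iter-lookup σ zero x = refl
iter-lookup σ (suc c) x = cong (lookup σ) (iter-lookup σ c x)

iter-injective : ∀ {n} (σ : Vec (Fin n) n) → isPerm σ ≡ true →
  ∀ a x y → iter σ a x ≡ iter σ a y → x ≡ y
iter-injective σ isPermσ zero x y e = e
iter-injective σ isPermσ (suc a) x y e =
  iter-injective σ isPermσ a x y (perm-injective σ isPermσ _ _ e)

iter-fixed : ∀ {n} (σ : Vec (Fin n) n) i → lookup σ i ≡ i → ∀ j → iter σ j i ≡ i
iter-fixed σ i σi≡i zero = refl
iter-fixed σ i σi≡i (suc j) = trans (cong (lookup σ) (iter-fixed σ i σi≡i j)) σi≡i

-- Every point of a permutation of [n] returns to itself within n steps
-- (pigeonhole on i, σ i, ..., σⁿ i, then cancel the common prefix).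
period : ∀ {n} (σ : Vec (Fin n) n) → isPerm σ ≡ true →
  ∀ i → ∃[ c ] (1 ≤ c × c ≤ n × iter σ c i ≡ i)
period {n} σ isPermσ i with pigeonhole (n<1+n n) (λ (a : Fin (suc n)) → iter σ (toℕ a) i)
... | a , b , a<b , same = c , m<n⇒0<n∸m a<b , c≤n , sym (iter-injective σ isPermσ (toℕ a) i _ same′)
  where
  c : ℕ
  c = toℕ b ∸ toℕ a
  c≤n : c ≤ n
  c≤n = ≤-trans (m∸n≤m (toℕ b) (toℕ a)) (≤-pred (toℕ<n b))
  same′ : iter σ (toℕ a) i ≡ iter σ (toℕ a) (iter σ c i)
  same′ = trans same (trans (cong (λ z → iter σ z i) (sym (m+[n∸m]≡n (<⇒≤ a<b)))) (iter-+ σ (toℕ a) c i))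

cycleMin-≤ : ∀ {n} (σ : Vec (Fin n) n) i → isCycleMin σ i ≡ true →
  ∀ j → j < n → toℕ i ≤ toℕ (iter σ j i)
cycleMin-≤ {n} σ i isMin j j<n = ≤ᵇ⇒≤ _ _ (Equivalence.from T-≡ (all-upTo⁻ _ id n isMin j j<n))

cycleMin-intro : ∀ {n} (σ : Vec (Fin n) n) i → (∀ j → toℕ i ≤ toℕ (iter σ j i)) → isCycleMin σ i ≡ true
cycleMin-intro {n} σ i h = all-upTo⁺ _ id n (λ j _ → Equivalence.to T-≡ (≤⇒≤ᵇ (h j)))

fixed⇒cycleMin : ∀ {n} (σ : Vec (Fin n) n) i → lookup σ i ≡ i → isCycleMin σ i ≡ true
fixed⇒cycleMin σ i σi≡i = cycleMin-intro σ i (λ j → ≤-reflexive (cong toℕ (sym (iter-fixed σ i σi≡i j))))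

cycleMin-≤-next : ∀ {n} (σ : Vec (Fin n) n) i → isCycleMin σ i ≡ true → toℕ i ≤ toℕ (lookup σ i)
cycleMin-≤-next {suc zero} σ fz isMin = z≤n
cycleMin-≤-next {suc (suc n)} σ i isMin = cycleMin-≤ σ i isMin 1 (s≤s (s≤s z≤n))

cycleMin-false : ∀ {n} (σ : Vec (Fin n) n) i → toℕ (lookup σ i) < toℕ i → isCycleMin σ i ≡ false
cycleMin-false σ i σi<i with isCycleMin σ i in isMin
... | true = ⊥-elim (<⇒≱ σi<i (cycleMin-≤-next σ i isMin))
... | false = refl

smaller-on-orbit : ∀ {n} (σ : Vec (Fin n) n) i → isCycleMin σ i ≡ false →
  ∃[ j ] (toℕ (iter σ j i) < toℕ i)
smaller-on-orbit {n} σ i notMin with all-upTo-false _ id n notMin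
... | j , _ , fails = j , ≰⇒> (λ le → subst T fails (≤⇒≤ᵇ le))

-- If i and σ i are both cycle minima then i is a fixed point: going once
-- around the cycle from σ i comes back to i, so σ i ≤ i ≤ σ i.
consecutive-minima-fixed : ∀ {n} (σ : Vec (Fin n) n) → isPerm σ ≡ true → ∀ i →
  isCycleMin σ i ≡ true → isCycleMin σ (lookup σ i) ≡ true → lookup σ i ≡ i
consecutive-minima-fixed σ isPermσ i iMin σiMin with period σ isPermσ i
... | suc c , _ , c<n , back = toℕ-injective (≤-antisym σi≤i (cycleMin-≤-next σ i iMin))
  where
  σi≤i : toℕ (lookup σ i) ≤ toℕ i
  σi≤i = subst (λ z → toℕ (lookup σ i) ≤ toℕ z) (trans (iter-lookup σ c i) back)
               (cycleMin-≤ σ (lookup σ i) σiMin c c<n)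

cycles-as-sum : ∀ {n} (σ : Vec (Fin n) n) → cycles σ ≡ ∑[ i < n ] ind (isCycleMin σ i)
cycles-as-sum σ = count-allFin (isCycleMin σ)

idPerm : ∀ n → Vec (Fin n) n
idPerm n = tabulate id

lookup-idPerm : ∀ {n} (i : Fin n) → lookup (idPerm n) i ≡ i
lookup-idPerm i = lookup∘tabulate id i

idPerm-isPerm : ∀ n → isPerm (idPerm n) ≡ true
idPerm-isPerm n = perm-from-injective (idPerm n) (λ i j e → trans (sym (lookup-idPerm i)) (trans e (lookup-idPerm j)))

idPerm-cycleMin : ∀ {n} (i : Fin n) → isCycleMin (idPerm n) i ≡ true
idPerm-cycleMin {n} i = fixed⇒cycleMin (idPerm n) i (lookup-idPerm i)

idPerm-cycles : ∀ n → cycles (idPerm n) ≡ n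
idPerm-cycles n = trans (cycles-as-sum (idPerm n)) (∑ind-all _ idPerm-cycleMin)

-- n cycles means every point is a cycle minimum, hence a fixed point.
n-cycles⇒idPerm : ∀ {n} (σ : Vec (Fin n) n) → isPerm σ ≡ true → cycles σ ≡ n → σ ≡ idPerm n
n-cycles⇒idPerm {n} σ isPermσ n-cycles =
  trans (sym (tabulate∘lookup σ))
        (tabulate-cong (λ i → consecutive-minima-fixed σ isPermσ i (allMin i) (allMin (lookup σ i))))
  where
  allMin : ∀ i → isCycleMin σ i ≡ true
  allMin = ∑ind-full (isCycleMin σ) (trans (sym (cycles-as-sum σ)) n-cycles)

record Mixed {n k} (t : ℕ) (σ : Vec (Fin n) n) (col : Vec (Fin k) n) : Set where
  field
    perm      : isPerm σ ≡ true
    colouring : isCycleColouring σ col ≡ true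
    total     : cycles σ ≡ t + k ∸ 1
    perColour : ∀ c → cyclesOfColour σ col c ≡ (if isSpecial c then t else 1)

mixed-sound : ∀ {n k} t (σ : Vec (Fin n) n) (col : Vec (Fin k) n) → isMixed t σ col ≡ true → Mixed t σ col
mixed-sound {n} {k} t σ col e
  with isPermσ , e₁ ← ∧-true {isPerm σ} e
  with isColouring , e₂ ← ∧-true {isCycleColouring σ col} e₁
  with totalTest , colourTests ← ∧-true {cycles σ ≡ᵇ (t + k ∸ 1)} e₂
  = record
  { perm      = isPermσ
  ; colouring = isColouring
  ; total     = ≡ᵇ-sound _ _ totalTest
  ; perColour = λ c → ≡ᵇ-sound _ _ (all-tabulate⁻ _ id colourTests c)
  }

Fin1-≡ᶠ : (x y : Fin 1) → (x ≡ᶠ y) ≡ true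
Fin1-≡ᶠ fz fz = refl

oneColour-mixed : ∀ {n} t (σ : Vec (Fin n) n) →
  isMixed {n} {1} t σ (replicate n fz) ≡ hasCycles σ t
oneColour-mixed {n} t σ = cong₂ (λ a b → isPerm σ ∧ (a ∧ b)) isColouring counts
  where
  col : Vec (Fin 1) n
  col = replicate n fz
  isColouring : isCycleColouring σ col ≡ true
  isColouring = all-tabulate⁺ (λ i → lookup col (lookup σ i) ≡ᶠ lookup col i) id
                              (λ i → Fin1-≡ᶠ (lookup col (lookup σ i)) (lookup col i))
  allOneColour : cyclesOfColour σ col fz ≡ cycles σ
  allOneColour =
    count-cong (λ i → trans (cong (isCycleMin σ i ∧_) (Fin1-≡ᶠ (lookup col i) fz)) (∧-identityʳ _)) (allFin n)
  counts : (cycles σ ≡ᵇ (t + 1 ∸ 1)) ∧ ((cyclesOfColour σ col fz ≡ᵇ t) ∧ true) ≡ (cycles σ ≡ᵇ t)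
  counts = trans (cong₂ (λ a b → (cycles σ ≡ᵇ a) ∧ ((b ≡ᵇ t) ∧ true)) (m+n∸n≡m t 1) allOneColour)
                 (trans (cong ((cycles σ ≡ᵇ t) ∧_) (∧-identityʳ _)) (∧-idem _))

part-ii : ∀ n t → mixedStirling n 1 t ≡ stirling1 n t
part-ii n t = begin
  mixedStirling n 1 t                                    ≡⟨ mixedStirling-as-sum n 1 t ⟩
  ∑ᵛ n n (λ σ → ∑ᵛ 1 n (λ col → ind (isMixed t σ col)))  ≡⟨ ∑ᵛ-cong n n uniqueColouring ⟩
  ∑ᵛ n n (λ σ → ind (hasCycles σ t))                     ≡⟨ stirling1-as-sum n t ⟨
  stirling1 n t                                          ∎
  where
  open ≡-Reasoning
  uniqueColouring : ∀ σ → ∑ᵛ 1 n (λ col → ind (isMixed t σ col)) ≡ ind (hasCycles σ t)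
  uniqueColouring σ = trans (∑ᵛ-unary n _) (cong ind (oneColour-mixed t σ))

-- Part (i).  A cycle colouring is constant along orbits, so every colour in
-- use is the colour of some cycle minimum (descend to smaller points on the
-- orbit until reaching a minimum).
colour-iter : ∀ {n k} (σ : Vec (Fin n) n) (col : Vec (Fin k) n) → isCycleColouring σ col ≡ true →
  ∀ j x → lookup col (iter σ j x) ≡ lookup col x
colour-iter σ col isColouring zero x = refl
colour-iter σ col isColouring (suc j) x =
  trans (≡ᶠ-sound (all-tabulate⁻ _ id isColouring (iter σ j x))) (colour-iter σ col isColouring j x)

colour-of-cycleMin : ∀ {n k} (σ : Vec (Fin n) n) (col : Vec (Fin k) n) → isCycleColouring σ col ≡ true →
  ∀ x → ∃[ y ] (isCycleMin σ y ≡ true × lookup col y ≡ lookup col x)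
colour-of-cycleMin {n} σ col isColouring x = <-rec Reaches descend (toℕ x) x refl
  where
  Reaches : ℕ → Set
  Reaches m = ∀ x → toℕ x ≡ m → ∃[ y ] (isCycleMin σ y ≡ true × lookup col y ≡ lookup col x)
  descend : ∀ m → (∀ {m′} → m′ < m → Reaches m′) → Reaches m
  descend m rec x refl with isCycleMin σ x in isMin
  ... | true = x , isMin , refl
  ... | false with smaller-on-orbit σ x isMin
  ... | j , smaller with rec smaller (iter σ j x) refl
  ... | y , yMin , sameColour = y , yMin , trans sameColour (colour-iter σ col isColouring j x)

no-special-colour : ∀ {n k} (σ : Vec (Fin n) n) (col : Vec (Fin (suc k)) n) →
  isMixed 0 σ col ≡ true → ∀ i → lookup col i ≢ fz
no-special-colour {n} σ col e i coli≡0
  with y , yMin , sameColour ← colour-of-cycleMin σ col (Mixed.colouring (mixed-sound 0 σ col e)) i =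
  special≢0 (∑-zero⁻ {n} (λ j → ind (isCycleMin σ j ∧ (lookup col j ≡ᶠ fz))) noSpecial y)
  where
  noSpecial : ∑[ j < n ] ind (isCycleMin σ j ∧ (lookup col j ≡ᶠ fz)) ≡ 0
  noSpecial = trans (sym (count-allFin {n} _)) (Mixed.perColour (mixed-sound 0 σ col e) fz)
  special≢0 : ind (isCycleMin σ y ∧ (lookup col y ≡ᶠ fz)) ≢ 0
  special≢0 rewrite yMin | trans sameColour coli≡0 = λ ()

shift-colours-mixed : ∀ {n k} (σ : Vec (Fin n) n) (col : Vec (Fin k) n) →
  isMixed 0 σ (vmap fs col) ≡ isMixed 1 σ col
shift-colours-mixed {n} {k} σ col =
  cong₂ (λ a b → isPerm σ ∧ (a ∧ ((cycles σ ≡ᵇ k) ∧ b))) sameColouring sameCounts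
  where
  col′ : Vec (Fin (suc k)) n
  col′ = vmap fs col
  sameColouring : isCycleColouring σ col′ ≡ isCycleColouring σ col
  sameColouring = all-tabulate-cong _ _ id id
    (λ i → cong₂ _≡ᶠ_ (lookup-map (lookup σ i) fs col) (lookup-map i fs col))
  specialUnused : cyclesOfColour σ col′ fz ≡ 0
  specialUnused =
    trans (count-cong (λ i → trans (cong (λ z → isCycleMin σ i ∧ (z ≡ᶠ fz)) (lookup-map i fs col))
                                   (∧-zeroʳ _))
                      (allFin n))
          (trans (count-allFin {n} (λ _ → false)) (∑-zero {n} (λ _ → refl)))
  shiftedCount : ∀ d → cyclesOfColour σ col′ (fs d) ≡ cyclesOfColour σ col d
  shiftedCount d =
    count-cong (λ i → cong (λ z → isCycleMin σ i ∧ (z ≡ᶠ fs d)) (lookup-map i fs col)) (allFin n)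
  if-same : ∀ (b : Bool) (x : ℕ) → (if b then x else x) ≡ x
  if-same true x = refl
  if-same false x = refl
  sameCounts : ((cyclesOfColour σ col′ fz ≡ᵇ 0) ∧
                 all (λ d → cyclesOfColour σ col′ d ≡ᵇ (if isSpecial d then 0 else 1)) (L.tabulate fs))
             ≡ all (λ d → cyclesOfColour σ col d ≡ᵇ (if isSpecial d then 1 else 1)) (allFin k)
  sameCounts rewrite specialUnused =
    all-tabulate-cong _ _ fs id (λ d → cong₂ _≡ᵇ_ (shiftedCount d) (sym (if-same (isSpecial d) 1)))

part-i : ∀ n k → 1 ≤ k → mixedStirling n k 0 ≡ mixedStirling n (k ∸ 1) 1
part-i n (suc k) _ = begin
  mixedStirling n (suc k) 0                                       ≡⟨ mixedStirling-as-sum n (suc k) 0 ⟩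
  ∑ᵛ n n (λ σ → ∑ᵛ (suc k) n (λ col → ind (isMixed 0 σ col)))     ≡⟨ ∑ᵛ-cong n n dropSpecial ⟩
  ∑ᵛ n n (λ σ → ∑ᵛ k n (λ col → ind (isMixed 1 σ col)))           ≡⟨ mixedStirling-as-sum n k 1 ⟨
  mixedStirling n k 1                                             ∎
  where
  open ≡-Reasoning
  dropSpecial : ∀ σ → ∑ᵛ (suc k) n (λ col → ind (isMixed 0 σ col))
                    ≡ ∑ᵛ k n (λ col → ind (isMixed 1 σ col))
  dropSpecial σ =
    trans (∑ᵛ-avoid-zero k n _ (λ col i coli≡0 → ind-≢true (λ e → no-special-colour σ col e i coli≡0)))
          (∑ᵛ-cong k n (λ col → cong ind (shift-colours-mixed σ col)))

-- Parts (iv) and (v) rest on the multinomial identity: the number of words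
-- of length n over Fin K with prescribed letter counts a, times ∏ (a c)!,
-- is n!.
∏ : ∀ {K} → (Fin K → ℕ) → ℕ
∏ {zero} f = 1
∏ {suc K} f = f fz * ∏ (f ∘ fs)

occurrences : ∀ {K n} → Fin K → Vec (Fin K) n → ℕ
occurrences {n = n} c v = ∑[ i < n ] ind (lookup v i ≡ᶠ c)

hasCounts : ∀ {K n} → (Fin K → ℕ) → Vec (Fin K) n → Bool
hasCounts {K} a v = all (λ c → occurrences c v ≡ᵇ a c) (allFin K)

removeOne : ∀ {K} → Fin K → (Fin K → ℕ) → Fin K → ℕ
removeOne x a c = a c ∸ ind (c ≡ᶠ x)

hasCounts-∷ : ∀ {K n} (a : Fin K → ℕ) x (v : Vec (Fin K) n) r → a x ≡ suc r →
  hasCounts a (x ∷ v) ≡ hasCounts (removeOne x a) v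
hasCounts-∷ a x v r ax = all-tabulate-cong _ _ id id perLetter
  where
  perLetter : ∀ c → (occurrences c (x ∷ v) ≡ᵇ a c) ≡ (occurrences c v ≡ᵇ removeOne x a c)
  perLetter c with c ≟ᶠ x
  ... | yes refl rewrite ≡ᶠ-refl c | ax = refl
  ... | no c≢x rewrite ≡ᶠ-false c≢x | ≡ᶠ-false (c≢x ∘ sym) = refl

hasCounts-absent : ∀ {K n} (a : Fin K → ℕ) x (v : Vec (Fin K) n) → a x ≡ 0 → hasCounts a (x ∷ v) ≡ false
hasCounts-absent a x v ax with hasCounts a (x ∷ v) in e
... | false = refl
... | true = ⊥-elim (contradiction (all-tabulate⁻ _ id e x))
  where
  contradiction : (occurrences x (x ∷ v) ≡ᵇ a x) ≡ true → ⊥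
  contradiction h rewrite ≡ᶠ-refl x | ax with h
  ... | ()

∑-removeOne : ∀ {K} (a : Fin K → ℕ) x r → a x ≡ suc r →
  ∑[ c < K ] a c ≡ suc (∑[ c < K ] removeOne x a c)
∑-removeOne a fz r ax rewrite ax = refl
∑-removeOne a (fs x) r ax rewrite ∑-removeOne (a ∘ fs) x r ax = +-suc (a fz) _

∏!-removeOne : ∀ {K} (a : Fin K → ℕ) x r → a x ≡ suc r →
  ∏ (λ c → a c !) ≡ a x * ∏ (λ c → removeOne x a c !)
∏!-removeOne a fz r ax rewrite ax = *-assoc (suc r) (r !) _
∏!-removeOne a (fs x) r ax rewrite ∏!-removeOne (a ∘ fs) x r ax = *-leftComm (a fz !) (a (fs x)) _

∏!-zero : ∀ {K} (a : Fin K → ℕ) → (∀ c → a c ≡ 0) → ∏ (λ c → a c !) ≡ 1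
∏!-zero {zero} a h = refl
∏!-zero {suc K} a h rewrite h fz | ∏!-zero (a ∘ fs) (h ∘ fs) = refl

multinomial : ∀ K n (a : Fin K → ℕ) → ∑[ c < K ] a c ≡ n →
  ∑ᵛ K n (ind ∘ hasCounts a) * ∏ (λ c → a c !) ≡ n !
multinomial K zero a ∑a≡0
  rewrite all-tabulate⁺ (λ c → 0 ≡ᵇ a c) id (λ c → cong (0 ≡ᵇ_) (∑-zero⁻ a ∑a≡0 c))
        | ∏!-zero a (∑-zero⁻ a ∑a≡0) = refl
multinomial K (suc n) a ∑a≡1+n = begin
  ∑ᵛ K (suc n) (ind ∘ hasCounts a) * P      ≡⟨ *-distribʳ-sum P startingWith ⟩
  ∑[ x < K ] (startingWith x * P)           ≡⟨ sum-cong-≗ firstLetter ⟩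
  ∑[ x < K ] (a x * n !)                    ≡⟨ *-distribʳ-sum (n !) a ⟨
  (∑[ x < K ] a x) * n !                    ≡⟨ cong (_* n !) ∑a≡1+n ⟩
  suc n !                                   ∎
  where
  open ≡-Reasoning
  P : ℕ
  P = ∏ (λ c → a c !)
  startingWith : Fin K → ℕ
  startingWith x = ∑ᵛ K n (λ v → ind (hasCounts a (x ∷ v)))
  -- Words starting with x: none if a x = 0, otherwise words with counts
  -- removeOne x a, counted by the induction hypothesis.
  firstLetter : ∀ x → startingWith x * P ≡ a x * n !
  firstLetter x with a x in ax
  ... | zero rewrite ∑ᵛ-zero K n (λ v → cong ind (hasCounts-absent a x v ax)) = refl
  ... | suc r = begin
    startingWith x * P    ≡⟨ cong₂ _*_ (∑ᵛ-cong K n (λ v → cong ind (hasCounts-∷ a x v r ax)))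
                                       (∏!-removeOne a x r ax) ⟩
    W * (a x * P′)        ≡⟨ *-leftComm W (a x) P′ ⟩
    a x * (W * P′)        ≡⟨ cong₂ _*_ ax (multinomial K n (removeOne x a) ∑removeOne≡n) ⟩
    suc r * n !           ∎
    where
    W : ℕ
    W = ∑ᵛ K n (ind ∘ hasCounts (removeOne x a))
    P′ : ℕ
    P′ = ∏ (λ c → removeOne x a c !)
    ∑removeOne≡n : ∑[ c < K ] removeOne x a c ≡ n
    ∑removeOne≡n = suc-injective (trans (sym (∑-removeOne a x r ax)) ∑a≡1+n)

mixedCounts : ∀ {m} → ℕ → Fin (suc m) → ℕ
mixedCounts t c = if isSpecial c then t else 1

∑-mixedCounts : ∀ m t → ∑[ c < suc m ] mixedCounts t c ≡ t + m
∑-mixedCounts m t = cong (t +_) (∑ind-all {m} (λ _ → true) (λ _ → refl))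

∏!-mixedCounts : ∀ m t → ∏ (λ c → mixedCounts {m} t c !) ≡ t !
∏!-mixedCounts m t = trans (cong (t ! *_) (∏!-zero {m} (λ _ → 0) (λ _ → refl))) (*-identityʳ (t !))

idPerm-colouring : ∀ {n k} (col : Vec (Fin k) n) → isCycleColouring (idPerm n) col ≡ true
idPerm-colouring {n} col = all-tabulate⁺ _ id
  (λ i → trans (cong (λ j → lookup col j ≡ᶠ lookup col i) (lookup-idPerm i)) (≡ᶠ-refl (lookup col i)))

identity-mixed : ∀ {n m} t (col : Vec (Fin (suc m)) n) → t + suc m ∸ 1 ≡ n →
  isMixed t (idPerm n) col ≡ hasCounts (mixedCounts t) col
identity-mixed {n} {m} t col total
  rewrite idPerm-isPerm n | idPerm-colouring col
        | ≡ᵇ-complete (cycles (idPerm n)) (t + suc m ∸ 1) (trans (idPerm-cycles n) (sym total))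
  = all-tabulate-cong _ _ id id (λ d → cong (_≡ᵇ mixedCounts t d) (colourCount d))
  where
  colourCount : ∀ d → cyclesOfColour (idPerm n) col d ≡ occurrences d col
  colourCount d =
    trans (count-allFin (λ i → isCycleMin (idPerm n) i ∧ (lookup col i ≡ᶠ d)))
          (sum-cong-≗ (λ i → cong (λ b → ind (b ∧ (lookup col i ≡ᶠ d))) (idPerm-cycleMin i)))

-- When t + (k - 1) = n, a mixed colouring needs n cycles, so only the
-- identity permutation carries any.
only-identity : ∀ {n k} t (σ : Vec (Fin n) n) → t + k ∸ 1 ≡ n → σ ≢ idPerm n →
  ∑ᵛ k n (λ col → ind (isMixed t σ col)) ≡ 0
only-identity {n} {k} t σ total σ≢id = ∑ᵛ-zero k n (λ col → ind-≢true (notMixed col))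
  where
  notMixed : ∀ col → isMixed t σ col ≢ true
  notMixed col e = σ≢id (n-cycles⇒idPerm σ (Mixed.perm m) (trans (Mixed.total m) total))
    where
    m : Mixed t σ col
    m = mixed-sound t σ col e

identity-colourings : ∀ n t m → t + m ≡ n → mixedStirling n (suc m) t * t ! ≡ n !
identity-colourings n t m t+m≡n = begin
  mixedStirling n (suc m) t * t !
    ≡⟨ cong (_* t !) (trans (mixedStirling-as-sum n (suc m) t)
                            (∑ᵛ-single n n _ (idPerm n) (λ σ → only-identity t σ total))) ⟩
  ∑ᵛ (suc m) n (λ col → ind (isMixed t (idPerm n) col)) * t !
    ≡⟨ cong₂ _*_ (∑ᵛ-cong (suc m) n (λ col → cong ind (identity-mixed t col total)))
                 (sym (∏!-mixedCounts m t)) ⟩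
  ∑ᵛ (suc m) n (ind ∘ hasCounts (mixedCounts t)) * ∏ (λ c → mixedCounts {m} t c !)
    ≡⟨ multinomial (suc m) n (mixedCounts t) (trans (∑-mixedCounts m t) t+m≡n) ⟩
  n !
    ∎
  where
  open ≡-Reasoning
  total : t + suc m ∸ 1 ≡ n
  total = trans (cong (_∸ 1) (+-suc t m)) t+m≡n

part-v : ∀ n t → t ≤ n → mixedStirling n (n ∸ t + 1) t ≡ factQuot n t
part-v n t t≤n = begin
  M                                ≡⟨ m*n/n≡m M (t !) {{t !≢0}} ⟨
  _/_ (M * t !) (t !) {{t !≢0}}    ≡⟨ cong (λ z → _/_ z (t !) {{t !≢0}}) M*t!≡n! ⟩
  factQuot n t                     ∎
  where
  open ≡-Reasoning
  M : ℕ
  M = mixedStirling n (n ∸ t + 1) t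
  M*t!≡n! : M * t ! ≡ n !
  M*t!≡n! rewrite +-comm (n ∸ t) 1 = identity-colourings n t (n ∸ t) (m+[n∸m]≡n t≤n)

part-iv : ∀ n → 1 ≤ n → mixedStirling n 2 (n ∸ 1) ≡ n
part-iv (suc n) _ = *-cancelʳ-≡ _ _ (n !) {{n !≢0}} (identity-colourings (suc n) n 1 (+-comm n 1))

swapping : ∀ {n} → Fin n → Fin n → Fin n → Fin n
swapping y J i = if i ≡ᶠ y then J else (if i ≡ᶠ J then y else i)

transposition : ∀ {n} → Fin n → Fin n → Vec (Fin n) n
transposition y J = tabulate (swapping y J)

lookup-transposition : ∀ {n} (y J i : Fin n) → lookup (transposition y J) i ≡ swapping y J i
lookup-transposition y J i = lookup∘tabulate (swapping y J) i

swapping-y : ∀ {n} (y J : Fin n) → swapping y J y ≡ J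
swapping-y y J rewrite ≡ᶠ-refl y = refl

swapping-J : ∀ {n} (y J : Fin n) → y ≢ J → swapping y J J ≡ y
swapping-J y J y≢J rewrite ≡ᶠ-false (y≢J ∘ sym) | ≡ᶠ-refl J = refl

swapping-other : ∀ {n} (y J i : Fin n) → i ≢ y → i ≢ J → swapping y J i ≡ i
swapping-other y J i i≢y i≢J rewrite ≡ᶠ-false i≢y | ≡ᶠ-false i≢J = refl

swapping-involutive : ∀ {n} (y J i : Fin n) → y ≢ J → swapping y J (swapping y J i) ≡ i
swapping-involutive y J i y≢J with i ≟ᶠ y | i ≟ᶠ J
... | yes refl | _ rewrite swapping-y i J = swapping-J i J y≢J
... | no i≢y | yes refl rewrite swapping-J y i y≢J = swapping-y y i
... | no i≢y | no i≢J rewrite swapping-other y J i i≢y i≢J = swapping-other y J i i≢y i≢J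

<⇒≢ᶠ : ∀ {n} {y J : Fin n} → toℕ y < toℕ J → y ≢ J
<⇒≢ᶠ y<J refl = <-irrefl refl y<J

transposition-isPerm : ∀ {n} (y J : Fin n) → y ≢ J → isPerm (transposition y J) ≡ true
transposition-isPerm y J y≢J = perm-from-injective (transposition y J) (λ i j e →
  trans (sym (swapping-involutive y J i y≢J))
        (trans (cong (swapping y J) (trans (sym (lookup-transposition y J i)) (trans e (lookup-transposition y J j))))
               (swapping-involutive y J j y≢J)))

transposition-orbit : ∀ {n} (y J : Fin n) → y ≢ J →
  ∀ j → (iter (transposition y J) j y ≡ y) ⊎ (iter (transposition y J) j y ≡ J)
transposition-orbit y J y≢J zero = inj₁ refl
transposition-orbit y J y≢J (suc j) with transposition-orbit y J y≢J j
... | inj₁ e = inj₂ (trans (cong (lookup (transposition y J)) e)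
                          (trans (lookup-transposition y J y) (swapping-y y J)))
... | inj₂ e = inj₁ (trans (cong (lookup (transposition y J)) e)
                          (trans (lookup-transposition y J J) (swapping-J y J y≢J)))

transposition-cycleMin : ∀ {n} (y J i : Fin n) → toℕ y < toℕ J → i ≢ J →
  isCycleMin (transposition y J) i ≡ true
transposition-cycleMin y J i y<J i≢J with i ≟ᶠ y
... | yes refl = cycleMin-intro (transposition i J) i (λ j → below (transposition-orbit i J (<⇒≢ᶠ y<J) j))
  where
  below : ∀ {z} → (z ≡ i) ⊎ (z ≡ J) → toℕ i ≤ toℕ z
  below (inj₁ refl) = ≤-refl
  below (inj₂ refl) = <⇒≤ y<J
... | no i≢y =
  fixed⇒cycleMin (transposition y J) i (trans (lookup-transposition y J i) (swapping-other y J i i≢y i≢J))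

transposition-¬cycleMin : ∀ {n} (y J : Fin n) → toℕ y < toℕ J → isCycleMin (transposition y J) J ≡ false
transposition-¬cycleMin y J y<J = cycleMin-false (transposition y J) J
  (subst (λ z → toℕ z < toℕ J) (sym (trans (lookup-transposition y J J) (swapping-J y J (<⇒≢ᶠ y<J)))) y<J)

transposition-hasCycles : ∀ {n} (y J : Fin n) → toℕ y < toℕ J → hasCycles (transposition y J) (n ∸ 1) ≡ true
transposition-hasCycles {suc n} y J y<J rewrite transposition-isPerm y J (<⇒≢ᶠ y<J) =
  ≡ᵇ-complete _ _ (trans (cycles-as-sum (transposition y J))
    (∑ind-allBut _ J (transposition-¬cycleMin y J y<J) (λ i i≢J → transposition-cycleMin y J i y<J i≢J)))

-- A transposition determines its larger point (the only non-minimum) and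
-- then its smaller one (the image of the larger).
transposition-injective : ∀ {n} {y J y′ J′ : Fin n} → toℕ y < toℕ J → toℕ y′ < toℕ J′ →
  transposition y J ≡ transposition y′ J′ → y ≡ y′ × J ≡ J′
transposition-injective {y = y} {J} {y′} {J′} y<J y′<J′ same with J ≟ᶠ J′
... | no J≢J′ = ⊥-elim (true≢false (begin
  true                                 ≡⟨ transposition-cycleMin y J J′ y<J (J≢J′ ∘ sym) ⟨
  isCycleMin (transposition y J) J′    ≡⟨ cong (λ τ → isCycleMin τ J′) same ⟩
  isCycleMin (transposition y′ J′) J′  ≡⟨ transposition-¬cycleMin y′ J′ y′<J′ ⟩
  false                                ∎))
  where open ≡-Reasoning
... | yes refl = trans (sym (swapping-J y J (<⇒≢ᶠ y<J)))
                   (trans (sym (lookup-transposition y J J))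
                     (trans (cong (λ τ → lookup τ J) same)
                       (trans (lookup-transposition y′ J J) (swapping-J y′ J (<⇒≢ᶠ y′<J′))))) , refl

-- Conversely, in a permutation of [n+1] with n cycles let J be the unique
-- point that is not a cycle minimum and y = σ J.  Then σ y = J (otherwise y
-- and σ y would be consecutive minima, making y fixed), y < J, and every
-- other point is fixed for the same reason.
hasCycles⇒transposition : ∀ {n} (σ : Vec (Fin (suc n)) (suc n)) → hasCycles σ n ≡ true →
  ∃[ y ] ∃[ J ] (toℕ y < toℕ J × σ ≡ transposition y J)
hasCycles⇒transposition {n} σ e
  with isPermσ , cycleTest ← ∧-true {isPerm σ} e
  with J , J-notMin , min ←
         ∑ind-unique-false (isCycleMin σ) (trans (sym (cycles-as-sum σ)) (≡ᵇ-sound _ _ cycleTest))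
  = y , J , y<J , trans (sym (tabulate∘lookup σ)) (tabulate-cong agrees)
  where
  s : Fin (suc n) → Fin (suc n)
  s = lookup σ
  y : Fin (suc n)
  y = s J
  y≢J : y ≢ J
  y≢J sJ≡J = true≢false (trans (sym (fixed⇒cycleMin σ J sJ≡J)) J-notMin)
  fixed : ∀ i → s i ≢ J → i ≢ J → s i ≡ i
  fixed i si≢J i≢J = consecutive-minima-fixed σ isPermσ i (min i i≢J) (min (s i) si≢J)
  sy≡J : s y ≡ J
  sy≡J with s y ≟ᶠ J
  ... | yes sy≡J = sy≡J
  ... | no sy≢J = ⊥-elim (y≢J (perm-injective σ isPermσ y J (fixed y sy≢J y≢J)))
  y<J : toℕ y < toℕ J
  y<J = ≤∧≢⇒< (subst (λ z → toℕ y ≤ toℕ z) sy≡J (cycleMin-≤-next σ y (min y y≢J)))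
              (y≢J ∘ toℕ-injective)
  agrees : ∀ i → s i ≡ swapping y J i
  agrees i with i ≟ᶠ y | i ≟ᶠ J
  ... | yes refl | _ = trans sy≡J (sym (swapping-y i J))
  ... | no _ | yes refl = sym (swapping-J y i y≢J)
  ... | no i≢y | no i≢J =
    trans (fixed i (λ si≡J → i≢y (perm-injective σ isPermσ i y (trans si≡J (sym sy≡J)))) i≢J)
          (sym (swapping-other y J i i≢y i≢J))

_≟ᵛ_ : ∀ {n} (u v : Vec (Fin n) n) → Dec (u ≡ v)
_≟ᵛ_ = ≡-dec _≟ᶠ_

isTransposition : ∀ {n} → Vec (Fin n) n → Fin n → Fin n → Bool
isTransposition σ y J = (toℕ y <ᵇ toℕ J) ∧ does (σ ≟ᵛ transposition y J)

isTransposition-sound : ∀ {n} {σ : Vec (Fin n) n} {y J} → isTransposition σ y J ≡ true →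
  toℕ y < toℕ J × σ ≡ transposition y J
isTransposition-sound {σ = σ} {y} {J} e
  with y<J , isτ ← ∧-true {toℕ y <ᵇ toℕ J} e
  with σ ≟ᵛ transposition y J
... | yes σ≡τ = <ᵇ⇒< _ _ (Equivalence.from T-≡ y<J) , σ≡τ
... | no _ = ⊥-elim (true≢false (sym isτ))

isTransposition-complete : ∀ {n} {σ : Vec (Fin n) n} {y J} → toℕ y < toℕ J → σ ≡ transposition y J →
  isTransposition σ y J ≡ true
isTransposition-complete {σ = σ} {y} {J} y<J σ≡τ
  rewrite Equivalence.to T-≡ (<⇒<ᵇ y<J) | dec-true (σ ≟ᵛ transposition y J) σ≡τ = refl

hasCycles-as-sum : ∀ {n} (σ : Vec (Fin (suc n)) (suc n)) →
  ind (hasCycles σ n) ≡ ∑[ J < suc n ] ∑[ y < suc n ] ind (isTransposition σ y J)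
hasCycles-as-sum {n} σ with hasCycles σ n in e
... | false = sym (∑-zero (λ J → ∑-zero (λ y → ind-≢true (notTransposition y J))))
  where
  notTransposition : ∀ y J → isTransposition σ y J ≢ true
  notTransposition y J t with y<J , σ≡τ ← isTransposition-sound t =
    true≢false (trans (sym (transposition-hasCycles y J y<J)) (trans (cong (λ τ → hasCycles τ n) (sym σ≡τ)) e))
... | true with y₀ , J₀ , y₀<J₀ , σ≡τ₀ ← hasCycles⇒transposition σ e =
  sym (trans (∑-single row J₀ otherRows)
             (trans (∑-single (λ y → ind (isTransposition σ y J₀)) y₀ otherEntries)
                    (cong ind (isTransposition-complete y₀<J₀ σ≡τ₀))))
  where
  row : Fin (suc n) → ℕ
  row J = ∑[ y < suc n ] ind (isTransposition σ y J)
  unique : ∀ {y J} → isTransposition σ y J ≡ true → y₀ ≡ y × J₀ ≡ J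
  unique t with y<J , σ≡τ ← isTransposition-sound t =
    transposition-injective y₀<J₀ y<J (trans (sym σ≡τ₀) σ≡τ)
  otherRows : ∀ J → J ≢ J₀ → row J ≡ 0
  otherRows J J≢J₀ = ∑-zero (λ y → ind-≢true (λ t → J≢J₀ (sym (proj₂ (unique {y} {J} t)))))
  otherEntries : ∀ y → y ≢ y₀ → ind (isTransposition σ y J₀) ≡ 0
  otherEntries y y≢y₀ = ind-≢true (λ t → y≢y₀ (sym (proj₁ (unique t))))

∑ᵛ-isTransposition : ∀ {n} (y J : Fin n) →
  ∑ᵛ n n (λ σ → ind (isTransposition σ y J)) ≡ ind (toℕ y <ᵇ toℕ J)
∑ᵛ-isTransposition {n} y J = trans (∑ᵛ-single n n _ (transposition y J) elsewhere) atτ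
  where
  elsewhere : ∀ σ → σ ≢ transposition y J → ind (isTransposition σ y J) ≡ 0
  elsewhere σ σ≢τ rewrite dec-false (σ ≟ᵛ transposition y J) σ≢τ | ∧-zeroʳ (toℕ y <ᵇ toℕ J) = refl
  atτ : ind (isTransposition (transposition y J) y J) ≡ ind (toℕ y <ᵇ toℕ J)
  atτ rewrite dec-true (transposition y J ≟ᵛ transposition y J) refl | ∧-identityʳ (toℕ y <ᵇ toℕ J) = refl

part-iii : ∀ n → 1 ≤ n → stirling1 n (n ∸ 1) ≡ n C 2
part-iii (suc n) _ = begin
  stirling1 N n
    ≡⟨ stirling1-as-sum N n ⟩
  ∑ᵛ N N (λ σ → ind (hasCycles σ n))
    ≡⟨ ∑ᵛ-cong N N hasCycles-as-sum ⟩
  ∑ᵛ N N (λ σ → ∑[ J < N ] ∑[ y < N ] ind (isTransposition σ y J))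
    ≡⟨ ∑ᵛ-swap N N (λ σ J → ∑[ y < N ] ind (isTransposition σ y J)) ⟩
  ∑[ J < N ] ∑ᵛ N N (λ σ → ∑[ y < N ] ind (isTransposition σ y J))
    ≡⟨ sum-cong-≗ (λ J → ∑ᵛ-swap N N (λ σ y → ind (isTransposition σ y J))) ⟩
  ∑[ J < N ] ∑[ y < N ] ∑ᵛ N N (λ σ → ind (isTransposition σ y J))
    ≡⟨ sum-cong-≗ (λ J → sum-cong-≗ (λ y → ∑ᵛ-isTransposition {N} y J)) ⟩
  ∑[ J < N ] ∑[ y < N ] ind (toℕ y <ᵇ toℕ J)
    ≡⟨ sum-cong-≗ (λ J → ∑ind-below N (toℕ J) (<⇒≤ (toℕ<n J))) ⟩
  ∑[ J < N ] toℕ J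
    ≡⟨ ∑-toℕ N ⟩
  N C 2
    ∎
  where
  open ≡-Reasoning
  N : ℕ
  N = suc n

mainTheorem5 : (n k t : ℕ) → 1 ≤ n → 1 ≤ k → 1 ≤ t → k ≤ n → t ≤ n →
    (mixedStirling n k 0 ≡ mixedStirling n (k ∸ 1) 1)
    × (mixedStirling n 1 t ≡ stirling1 n t)
    × (mixedStirling n 1 (n ∸ 1) ≡ n C 2 × n C 2 ≡ stirling1 n (n ∸ 1))
    × (mixedStirling n 2 (n ∸ 1) ≡ n)
    × (mixedStirling n (n ∸ t + 1) t ≡ factQuot n t)
mainTheorem5 n k t 1≤n 1≤k _ _ t≤n =
    part-i n k 1≤k
  , part-ii n t
  , (trans (part-ii n (n ∸ 1)) (part-iii n 1≤n) , sym (part-iii n 1≤n))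
  , part-iv n 1≤n
  , part-v n t t≤n
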